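{- Let $s,t,a$ be integers with $2\le a\le s\le t$ and $a(s+t-a-2)\ge s+t-1$. Then $$r\!\left(K_{n,n},K_{s,t},\,st-a(s+t-a-2)+1\right)=\Omega\!\left(n^{1/a}\right).$$
   Context: For graphs $G,H$ and an integer $q$ with $2\le q\le |E(H)|$, an $(H,q)$-coloring of $G$ is an edge-coloring of $G$ in which every subgraph of $G$ isomorphic to $H$ receives at least $q$ distinct colors; $r(G,H,q)$ is the minimum number of colors needed for $G$ to have an $(H,q)$-coloring. $K_{n,n}$, $K_{s,t}$ denote complete bipartite graphs. Asymptotic notation refers to $n\to\infty$ with $s,t,a$ fixed. -}

module Defs where

open import Data.Nat using (ℕ; _*_; _∸_; _+_; _≤_)
open import Data.Fin using (Fin)
open import Data.Product using (Σ; _×_; _,_; proj₁; proj₂; ∃)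
open import Data.Sum using (_⊎_)
open import Function.Definitions using (Injective)
open import Relation.Binary.PropositionalEquality using (_≡_)

-- An edge-colouring of K_{n,n} with k colours.  Vertices are the two
-- copies of Fin n (left side / right side); edge (i , j) joins left
-- vertex i to right vertex j; its colour is c i j.
Colouring : ℕ → ℕ → Set
Colouring n k = Fin n → Fin n → Fin k

record Copy (n s t : ℕ) : Set where
  field
    f    : Fin s → Fin n
    g    : Fin t → Fin n
    f-inj : Injective _≡_ _≡_ f
    g-inj : Injective _≡_ _≡_ g

colL : ∀ {n k s t} → Colouring n k → Copy n s t → Fin s × Fin t → Fin k
colL c K (i , j) = c (Copy.f K i) (Copy.g K j)

colR : ∀ {n k s t} → Colouring n k → Copy n s t → Fin s × Fin t → Fin k
colR c K (i , j) = c (Copy.g K j) (Copy.f K i)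

AtLeastColours : ∀ {s t k} → ℕ → (Fin s × Fin t → Fin k) → Set
AtLeastColours {s} {t} q χ =
  Σ (Fin q → Fin s × Fin t) λ e → Injective _≡_ _≡_ (λ m → χ (e m))

-- (K_{s,t}, q)-colouring of K_{n,n}: every subgraph isomorphic to K_{s,t}
-- receives at least q distinct colours.  Since s,t ≥ 1, every such subgraph
-- has its s-part on one side and its t-part on the other side.
IsHqColouring : ∀ {n k} → (s t q : ℕ) → Colouring n k → Set
IsHqColouring {n} s t q c =
  (K : Copy n s t) → AtLeastColours q (colL c K) × AtLeastColours q (colR c K)

-- G = K_{n,n} admits a (K_{s,t}, q)-colouring using k colours.
-- r(K_{n,n}, K_{s,t}, q) is the least k for which this holds.
HasColouring : (n s t q k : ℕ) → Set
HasColouring n s t q k = Σ (Colouring n k) (IsHqColouring s t q)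

-- Fix a left vertices X. If n > (s + t) k^a, pigeonholing the right vertices by the
-- colours of their edges to X gives t right vertices Y all seeing X in the same colours;
-- let Y₀ be a of them. Pigeonholing the other left vertices by their colours towards Y₀
-- gives u = s − a left vertices Z all seeing Y₀ in the same colours. In the copy of
-- K_{s,t} on X ∪ Z and Y, the colour of an edge at X depends only on its end in X, and
-- that of an edge from Z to Y₀ only on its end in Y₀, so at most
-- 2a + uv = st − a(s + t − a − 2) colours occur.

module Submission where

open import Defs
open import Data.Nat using (ℕ; _*_; _∸_; _+_; _≤_; _^_)
open import Data.Product using (Σ; _×_)

open import Data.Nat using (zero; suc; z≤n; s≤s; _<_; _≟_; _≤?_; NonZero)
open import Data.Nat.Properties
open import Data.Nat.Tactic.RingSolver using (solve-∀)
open import Data.Fin as Fin using (Fin; toℕ; inject≤; _↑ˡ_; _↑ʳ_; splitAt; join; funToFin; finToFun)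
open import Data.Fin.Properties
  using (toℕ-injective; toℕ<n; inject≤-injective; join-splitAt; finToFun-funToFin; +↔⊎; *↔×; ¬Fin0; injective⇒≤)
open import Data.List using (List; []; _∷_; length; filter; lookup; allFin)
open import Data.List.Properties using (filter-all; length-tabulate)
open import Data.List.Membership.Propositional.Properties using (∈-lookup)
open import Data.List.Relation.Unary.All as All using (All)
open import Data.List.Relation.Unary.All.Properties using (all-filter) renaming (filter⁺ to All-filter⁺)
open import Data.List.Relation.Unary.AllPairs using (_∷_)
open import Data.List.Relation.Unary.Unique.Propositional using (Unique)
open import Data.List.Relation.Unary.Unique.Propositional.Properties
  using (allFin⁺) renaming (filter⁺ to Unique-filter⁺)
open import Data.List.Relation.Binary.Sublist.Propositional.Properties using (filter-⊆; filter⁺; length-mono-≤)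
open import Data.Product using (∃-syntax; _,_; proj₁; proj₂)
open import Data.Sum using (_⊎_; inj₁; inj₂; map₂)
open import Data.Sum.Function.Propositional using (_⊎-↔_; _⊎-↣_)
open import Data.Empty using (⊥-elim)
open import Function using (_∘_; id)
open import Function.Bundles using (_↣_; Injection; mk↣)
open import Function.Definitions using (Injective)
open import Function.Properties.Inverse using (↔⇒↣; ↔-sym; ↔-trans; ↔-refl)
open import Function.Properties.Injection using (↣-trans; ↣-refl)
open import Level using (0ℓ)
open import Relation.Nullary using (yes; no; contradiction)
open import Relation.Binary.PropositionalEquality
open import Relation.Unary using (Pred; Decidable)
open import Relation.Unary.Properties using (∁?)

length≤filter+filter-∁ : ∀ {A : Set} {P : Pred A 0ℓ} (P? : Decidable P) (xs : List A) →
  length xs ≤ length (filter P? xs) + length (filter (∁? P?) xs)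
length≤filter+filter-∁ P? [] = z≤n
length≤filter+filter-∁ P? (x ∷ xs) with P? x
... | yes _ = s≤s (length≤filter+filter-∁ P? xs)
... | no  _ = ≤-trans (s≤s (length≤filter+filter-∁ P? xs)) (≤-reflexive (sym (+-suc _ _)))

-- Labels are natural numbers bounded on the list, so that discarding the top label
-- leaves an instance of the same problem with one label fewer.
module _ {A : Set} (f : A → ℕ) where

  large-fibre : ∀ m r (xs : List A) → All (λ x → f x < suc m) xs → r * suc m ≤ length xs →
                ∃[ c ] r ≤ length (filter (λ x → f x ≟ c) xs)
  large-fibre zero r xs bounded large =
    0 , subst (r ≤_) (cong length (sym (filter-all (λ x → f x ≟ 0) (All.map n<1⇒n≡0 bounded))))
              (≤-trans (≤-reflexive (sym (*-identityʳ r))) large)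
  large-fibre (suc m) r xs bounded large with r ≤? length (filter (λ x → f x ≟ suc m) xs)
  ... | yes top-large = suc m , top-large
  ... | no top-small with large-fibre m r rest rest-bounded rest-large
    where
    top? = λ x → f x ≟ suc m
    rest = filter (∁? top?) xs
    rest-bounded : All (λ x → f x < suc m) rest
    rest-bounded = All.zipWith (λ (lt , ne) → ≤∧≢⇒< (≤-pred lt) ne)
                     (All-filter⁺ (∁? top?) bounded , all-filter (∁? top?) xs)
    rest-large : r * suc m ≤ length rest
    rest-large = +-cancelˡ-≤ r _ _ (begin
      r + r * suc m                                ≡⟨ *-suc r (suc m) ⟨
      r * suc (suc m)                              ≤⟨ large ⟩
      length xs                                    ≤⟨ length≤filter+filter-∁ top? xs ⟩
      length (filter top? xs) + length rest        ≤⟨ +-monoˡ-≤ (length rest) (≰⇒≥ top-small) ⟩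
      r + length rest                              ∎)
      where open ≤-Reasoning
  ... | c , fibre-large =
    c , ≤-trans fibre-large (length-mono-≤ (filter⁺ P? P? (λ { refl → id }) (filter-⊆ _ xs)))
    where P? = λ x → f x ≟ c

lookup-injective : ∀ {A : Set} {xs : List A} → Unique xs → Injective _≡_ _≡_ (lookup xs)
lookup-injective (_ ∷ _) {Fin.zero} {Fin.zero} _ = refl
lookup-injective (x∉xs ∷ _) {Fin.zero} {Fin.suc j} eq =
  ⊥-elim (All.lookup x∉xs (∈-lookup j) eq)
lookup-injective (x∉xs ∷ _) {Fin.suc i} {Fin.zero} eq =
  ⊥-elim (All.lookup x∉xs (∈-lookup i) (sym eq))
lookup-injective (_ ∷ unique) {Fin.suc i} {Fin.suc j} eq =
  cong Fin.suc (lookup-injective unique eq)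

pigeonhole-fibre : ∀ {n m} .{{_ : NonZero m}} r (f : Fin n → Fin m) → r * m ≤ n →
  ∃[ c ] Σ (Fin r → Fin n) λ h → Injective _≡_ _≡_ h × (∀ j → f (h j) ≡ c)
pigeonhole-fibre {m = suc m} zero f _ = Fin.zero , (λ ()) , (λ { {()} }) , (λ ())
pigeonhole-fibre {n} {suc m} (suc r) f large
  with large-fibre (toℕ ∘ f) m (suc r) (allFin n) (All.universal (toℕ<n ∘ f) (allFin n))
         (subst (suc r * suc m ≤_) (sym (length-tabulate id)) large)
... | c , fibre-large =
  f (h Fin.zero) , h , h-injective , λ j → toℕ-injective (trans (on-fibre j) (sym (on-fibre Fin.zero)))
  where
  c? = λ x → toℕ (f x) ≟ c
  fibre = filter c? (allFin n)
  h : Fin (suc r) → Fin n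
  h j = lookup fibre (inject≤ j fibre-large)
  h-injective : Injective _≡_ _≡_ h
  h-injective eq = inject≤-injective _ _ _ _ (lookup-injective (Unique-filter⁺ c? (allFin⁺ n)) eq)
  on-fibre : ∀ j → toℕ (f (h j)) ≡ c
  on-fibre j = All.lookup (all-filter c? (allFin n)) (∈-lookup _)

AtLeastColours⇒≤ : ∀ {s t k q Q} {B : Set} {χ : Fin s × Fin t → Fin k}
  (κ : Fin s × Fin t → B) (χ′ : B → Fin k) → B ↣ Fin Q →
  (∀ e → χ e ≡ χ′ (κ e)) → AtLeastColours q χ → q ≤ Q
AtLeastColours⇒≤ {χ = χ} κ χ′ ι factor (e , distinct) =
  injective⇒≤ {f = Injection.to ι ∘ κ ∘ e} λ {i} {j} eq → distinct (begin
    χ (e i)       ≡⟨ factor (e i) ⟩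
    χ′ (κ (e i))  ≡⟨ cong χ′ (Injection.injective ι eq) ⟩
    χ′ (κ (e j))  ≡⟨ factor (e j) ⟨
    χ (e j)       ∎)
  where open ≡-Reasoning

ColourClass : ℕ → ℕ → ℕ → Set
ColourClass a u v = Fin a ⊎ (Fin a ⊎ Fin u × Fin v)

ColourClass↣Fin : ∀ a u v → ColourClass a u v ↣ Fin (a + (a + u * v))
ColourClass↣Fin a u v = ↔⇒↣ (↔-sym (↔-trans +↔⊎ (↔-refl ⊎-↔ (↔-trans +↔⊎ (↔-refl ⊎-↔ *↔×)))))

classOf : ∀ {a u v} → Fin a ⊎ Fin u → Fin a ⊎ Fin v → ColourClass a u v
classOf (inj₁ i) _        = inj₁ i
classOf (inj₂ _) (inj₁ j) = inj₂ (inj₁ j)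
classOf (inj₂ w) (inj₂ w′) = inj₂ (inj₂ (w , w′))

id+↣ : ∀ a {m n} → Fin m ↣ Fin n → Fin (a + m) ↣ Fin (a + n)
id+↣ a g = ↣-trans (↔⇒↣ +↔⊎) (↣-trans (↣-refl ⊎-↣ g) (↔⇒↣ (↔-sym +↔⊎)))

funToFin≡⇒ : ∀ {a k} {g : Fin a → Fin k} {p} → funToFin g ≡ p → ∀ i → g i ≡ finToFun p i
funToFin≡⇒ {g = g} refl i = sym (finToFun-funToFin g i)

-- A vertex's colours towards an a-tuple of vertices are encoded by funToFin as one
-- colour in Fin (k ^ a), so that a single pigeonhole step equalises all of them.
few-coloured-copy : ∀ {k} .{{_ : NonZero k}} a u v m (c : Colouring (a + m) k) →
  (a + v) * k ^ a ≤ a + m → u * k ^ a ≤ m →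
  Σ (Copy (a + m) (a + u) (a + v)) λ H → ∀ {q} → AtLeastColours q (colL c H) → q ≤ a + (a + u * v)
few-coloured-copy {k} a u v m c Y-room Z-room
  with pigeonhole-fibre {{m^n≢0 k a}} (a + v) (λ y → funToFin λ i → c (i ↑ˡ m) y) Y-room
... | cY , Y , Y-injective , Y-profile
  with pigeonhole-fibre {{m^n≢0 k a}} u (λ w → funToFin λ j → c (a ↑ʳ w) (Y (j ↑ˡ v))) Z-room
... | cZ , Z , Z-injective , Z-profile =
  H , AtLeastColours⇒≤ κ χ′ (ColourClass↣Fin a u v) factor
  where
  left : Fin (a + u) ↣ Fin (a + m)
  left = id+↣ a (mk↣ Z-injective)
  H : Copy (a + m) (a + u) (a + v)
  H = record { f = Injection.to left ; g = Y ; f-inj = Injection.injective left ; g-inj = Y-injective }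
  κ : Fin (a + u) × Fin (a + v) → ColourClass a u v
  κ (p , p′) = classOf (splitAt a p) (splitAt a p′)
  χ′ : ColourClass a u v → Fin k
  χ′ (inj₁ i)                = finToFun cY i
  χ′ (inj₂ (inj₁ j))         = finToFun cZ j
  χ′ (inj₂ (inj₂ (w , w′))) = c (a ↑ʳ Z w) (Y (a ↑ʳ w′))
  edge-colour : ∀ σ τ → c (join a m (map₂ Z σ)) (Y (join a v τ)) ≡ χ′ (classOf σ τ)
  edge-colour (inj₁ i) τ        = funToFin≡⇒ (Y-profile (join a v τ)) i
  edge-colour (inj₂ w) (inj₁ j) = funToFin≡⇒ (Z-profile w) j
  edge-colour (inj₂ w) (inj₂ w′) = refl
  factor : ∀ e → colL c H e ≡ χ′ (κ e)
  factor (p , p′) =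
    trans (cong (c _ ∘ Y) (sym (join-splitAt a v p′))) (edge-colour (splitAt a p) (splitAt a p′))

room-for-copy : ∀ a u v P .{{_ : NonZero P}} {n} → (a + u + (a + v)) * P ≤ n →
  ∃[ m ] a + m ≡ n × (a + v) * P ≤ n × u * P ≤ m
room-for-copy a u v P {n} large =
  m , a+m≡n , Y-room , +-cancelˡ-≤ a _ _ (subst (a + u * P ≤_) (sym a+m≡n) Z-room)
  where
  open ≤-Reasoning
  Y-room : (a + v) * P ≤ n
  Y-room = ≤-trans (*-monoˡ-≤ P (m≤n+m (a + v) (a + u))) large
  Z-room : a + u * P ≤ n
  Z-room = begin
    a + u * P            ≤⟨ +-monoˡ-≤ (u * P) (m≤m*n a P) ⟩
    a * P + u * P        ≡⟨ *-distribʳ-+ P a u ⟨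
    (a + u) * P          ≤⟨ *-monoˡ-≤ P (m≤m+n (a + u) (a + v)) ⟩
    (a + u + (a + v)) * P ≤⟨ large ⟩
    n                    ∎
  split : ∃[ m ] a + m ≡ n
  split = m≤n⇒∃[o]m+o≡n (≤-trans (m≤m+n a (u * P)) Z-room)
  m = proj₁ split
  a+m≡n = proj₂ split

colouring-bound : ∀ a u v n k → HasColouring n (a + u) (a + v) (suc (a + (a + u * v))) k →
  n ≤ (a + u + (a + v)) * k ^ a
colouring-bound a u v zero    zero _       = z≤n
colouring-bound a u v (suc n) zero (c , _) = ⊥-elim (¬Fin0 (c Fin.zero Fin.zero))
colouring-bound a u v n (suc k) (c , q-colouring) with n ≤? (a + u + (a + v)) * suc k ^ a
... | yes bounded = bounded
... | no unbounded with room-for-copy a u v (suc k ^ a) {{m^n≢0 (suc k) a}} (<⇒≤ (≰⇒> unbounded))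
... | m , refl , Y-room , Z-room with few-coloured-copy a u v m c Y-room Z-room
... | H , few-colours = contradiction (few-colours (proj₁ (q-colouring H))) 1+n≰n

sum-split : ∀ b u v → (2 + b + u) + (2 + b + v) ≡ (2 + b) + (2 + (b + u + v))
sum-split = solve-∀

product-split : ∀ b u v → (2 + b + u) * (2 + b + v) ≡ (2 + b) * (b + u + v) + (2 + b + (2 + b + u * v))
product-split = solve-∀

forbidden-q≡ : ∀ b u v → let a = 2 + b; s = a + u; t = a + v in
  s * t ∸ a * (s + t ∸ a ∸ 2) + 1 ≡ suc (a + (a + u * v))
forbidden-q≡ b u v = begin
  s * t ∸ a * (s + t ∸ a ∸ 2) + 1                            ≡⟨ cong (λ x → s * t ∸ a * (x ∸ a ∸ 2) + 1) (sum-split b u v) ⟩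
  s * t ∸ a * (a + (2 + (b + u + v)) ∸ a ∸ 2) + 1            ≡⟨ cong (λ x → s * t ∸ a * (x ∸ 2) + 1) (m+n∸m≡n a _) ⟩
  s * t ∸ a * (b + u + v) + 1                                ≡⟨ cong (λ x → x ∸ a * (b + u + v) + 1) (product-split b u v) ⟩
  a * (b + u + v) + (a + (a + u * v)) ∸ a * (b + u + v) + 1  ≡⟨ cong (_+ 1) (m+n∸m≡n (a * (b + u + v)) _) ⟩
  a + (a + u * v) + 1                                        ≡⟨ +-comm _ 1 ⟩
  suc (a + (a + u * v))                                      ∎
  where
  open ≡-Reasoning
  a = 2 + b
  s = a + u
  t = a + v

theorem1p13 : (s t a : ℕ) → 2 ≤ a → a ≤ s → s ≤ t →
    s + t ∸ 1 ≤ a * (s + t ∸ a ∸ 2) →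
    Σ ℕ λ C → Σ ℕ λ N → 1 ≤ C ×
      ((n k : ℕ) → N ≤ n →
        HasColouring n s t (s * t ∸ a * (s + t ∸ a ∸ 2) + 1) k →
        n ≤ C * k ^ a)
theorem1p13 s t a@(suc (suc b)) (s≤s (s≤s z≤n)) a≤s s≤t _
  with m≤n⇒∃[o]m+o≡n a≤s | m≤n⇒∃[o]m+o≡n (≤-trans a≤s s≤t)
... | u , refl | v , refl = s + t , 0 , s≤s z≤n , λ n k _ →
  colouring-bound a u v n k ∘ subst (λ q → HasColouring n s t q k) (forbidden-q≡ b u v)
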